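{- Let $G$ be a connected unit interval graph on $n$ vertices with lower bounds $\mathrm{lbound}:V(G)\to\mathbb{Q}\cup\{ -\infty\}$ such that $\mathrm{lbound}(v)>-\infty$ for at least one vertex $v$. Fix $\varepsilon=1/K$ with $K\ge n$ a positive integer and a partial order $<$ on $V(G)$ as in the context. Then the left-most representation in $\mathfrak{Rep}$ exists and is unique.
   Context: A unit interval representation of $G$ is an assignment of reals $\ell_v$ ($v\in V(G)$) such that $uv\in E(G)$ iff $|\ell_u-\ell_v|\le 1$. It is an $\varepsilon$-grid representation if every $\ell_v$ is an integer multiple of $\varepsilon$. Vertices $u,v$ are indistinguishable if $N[u]=N[v]$. The partial order $<$ is fixed so that two distinct vertices are comparable iff they are not indistinguishable, and $<$ is the left-to-right order of the intervals of some unit interval representation of $G$. $\mathfrak{Rep}$ is the set of all $\varepsilon$-grid representations of $G$ with $\ell_u<\ell_v$ whenever $u<v$ and $\ell_v\ge\mathrm{lbound}(v)$ for all $v$, ordered by $\mathcal{R}\le\mathcal{R}'$ iff $\ell_v\le\ell'_v$ for all $v$. A representation $\mathcal{R}\in\mathfrak{Rep}$ is the left-most representation if $\mathcal{R}\le\mathcal{R}'$ for every $\mathcal{R}'\in\mathfrak{Rep}$.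
   Formalization: The unit interval representations witnessing that $G$ is a unit interval graph and that $<$ is its left-to-right order take values in ℚ rather than in the reals. -}

module Defs where

open import Level using (0ℓ)
open import Data.Nat as ℕ using (ℕ; suc)
open import Data.Fin using (Fin)
open import Data.Integer using (ℤ; +_)
open import Data.Rational using (ℚ; _/_; _≤_; _<_; _-_; _*_; ∣_∣; 1ℚ)
open import Data.Maybe using (Maybe; just; nothing)
open import Data.Product using (Σ; ∃; _×_; _,_)
open import Data.Sum using (_⊎_)
open import Data.Unit using (⊤)
open import Data.Empty using (⊥)
open import Relation.Nullary using (¬_)
open import Relation.Binary.PropositionalEquality using (_≡_; _≢_)
open import Function.Bundles using (_⇔_)

record Graph (n : ℕ) : Set₁ where
  field
    Adj   : Fin n → Fin n → Set
    sym   : ∀ {u v} → Adj u v → Adj v u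
    irrefl : ∀ {v} → ¬ Adj v v
open Graph public

data Reach {n : ℕ} (G : Graph n) : Fin n → Fin n → Set where
  here : ∀ {u} → Reach G u u
  step : ∀ {u w v} → Adj G u w → Reach G w v → Reach G u v

Connected : {n : ℕ} → Graph n → Set
Connected G = ∀ u v → Reach G u v

-- Positions of the (left endpoints of the) unit intervals.
Positions : ℕ → Set
Positions n = Fin n → ℚ

IsUnitIntervalRep : {n : ℕ} → Graph n → Positions n → Set
IsUnitIntervalRep G ℓ = ∀ u v → u ≢ v → (Adj G u v ⇔ (∣ ℓ u - ℓ v ∣ ≤ 1ℚ))

IsUnitIntervalGraph : {n : ℕ} → Graph n → Set
IsUnitIntervalGraph G = ∃ λ ℓ → IsUnitIntervalRep G ℓ

ε : (K : ℕ) → .{{_ : ℕ.NonZero K}} → ℚ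
ε K = + 1 / K

IsGrid : {n : ℕ} (K : ℕ) → .{{_ : ℕ.NonZero K}} → Positions n → Set
IsGrid K ℓ = ∀ v → ∃ λ (k : ℤ) → ℓ v ≡ (k / 1) * ε K

InClosedNbhd : {n : ℕ} → Graph n → Fin n → Fin n → Set
InClosedNbhd G u w = (w ≡ u) ⊎ Adj G u w

Indist : {n : ℕ} → Graph n → Fin n → Fin n → Set
Indist G u v = ∀ w → (InClosedNbhd G u w ⇔ InClosedNbhd G v w)

-- The fixed partial order < on V(G) as in the context: a strict partial order,
-- distinct vertices comparable iff not indistinguishable, and it is the
-- left-to-right order of some unit interval representation of G.
record AdmissibleOrder {n : ℕ} (G : Graph n) (_≺_ : Fin n → Fin n → Set) : Set where
  field
    irrefl  : ∀ {v} → ¬ (v ≺ v)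
    trans   : ∀ {u v w} → u ≺ v → v ≺ w → u ≺ w
    compar  : ∀ u v → u ≢ v → ((u ≺ v ⊎ v ≺ u) ⇔ (¬ Indist G u v))
    realized : ∃ λ ℓ → IsUnitIntervalRep G ℓ × (∀ u v → u ≺ v → ℓ u < ℓ v)

-- lower bounds: nothing encodes -∞
AboveLB : Maybe ℚ → ℚ → Set
AboveLB nothing  x = ⊤
AboveLB (just b) x = b ≤ x

InRep : {n : ℕ} (G : Graph n) (K : ℕ) → .{{_ : ℕ.NonZero K}} →
        (Fin n → Fin n → Set) → (Fin n → Maybe ℚ) → Positions n → Set
InRep G K _≺_ lbound ℓ =
  IsUnitIntervalRep G ℓ × IsGrid K ℓ ×
  (∀ u v → u ≺ v → ℓ u < ℓ v) × (∀ v → AboveLB (lbound v) (ℓ v))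

_≤R_ : {n : ℕ} → Positions n → Positions n → Set
ℓ ≤R ℓ' = ∀ v → ℓ v ≤ ℓ' v

IsLeftmost : {n : ℕ} (G : Graph n) (K : ℕ) → .{{_ : ℕ.NonZero K}} →
             (Fin n → Fin n → Set) → (Fin n → Maybe ℚ) → Positions n → Set
IsLeftmost G K _≺_ lbound ℓ =
  InRep G K _≺_ lbound ℓ × (∀ ℓ' → InRep G K _≺_ lbound ℓ' → ℓ ≤R ℓ')

module Submission where

-- Writing ℓ_v = x_v / K, an ε-grid representation in 𝔯𝔢𝔭 is the same as an integer vector x
-- satisfying difference constraints w + x_u ≤ x_v (weight 1 or K + 1 from u to v when u < v,
-- according as u, v are adjacent or not; weight −K between adjacent u, v with u ≮ v) and lower
-- bounds x_v ≥ lower_v (lbound rounded up to the grid, or for an unbounded vertex the bound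
-- forced by a walk from a bounded one).  A system of difference constraints with lower bounds
-- and no positive cycle of length ≤ n has a least solution, reached after n rounds of
-- Bellman–Ford relaxation; this least solution is the left-most representation.  Cycles are
-- controlled by the representation realizing <: a constraint u → v of weight w = a − K·b
-- (a ∈ {0, 1}) is matched by ℓ_u ≤ b + ℓ_v, strictly when a = 1.  Around a cycle this gives
-- 0 ≤ Σ b, strictly if Σ a > 0, so the weight Σ a − K·Σ b is ≤ 0 because Σ a ≤ n ≤ K.

open import Defs
open import Data.Nat using (ℕ; _≤_; NonZero)
open import Data.Fin using (Fin)
open import Data.Rational using (ℚ)
open import Data.Maybe using (Maybe; just)
open import Data.Product using (∃; _×_)
open import Relation.Binary.PropositionalEquality using (_≡_)

import Data.Nat as ℕ
import Data.Nat.Properties as ℕ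
open import Data.Nat using (_<_; zero; suc; z≤n; s≤s)
open import Data.Integer using (ℤ; +_; -[1+_]; 0ℤ; _+_; _-_; _*_; -_; +≤+)
import Data.Integer as ℤ
import Data.Integer.Properties as ℤ
open import Data.Integer.DivMod using (_/ℕ_; [n/ℕd]*d≤n; n<s[n/ℕd]*d)
open import Data.Integer.Tactic.RingSolver using (solve-∀)
open import Data.Rational using (mkℚ; _/_; 0ℚ; 1ℚ; ∣_∣)
import Data.Rational as ℚ
import Data.Rational.Properties as ℚ
import Data.Rational.Solver as ℚ-Solver
open import Data.Rational.Unnormalised using (mkℚᵘ; *≤*; *<*; *≡*)
import Data.Rational.Unnormalised as ℚᵘ
import Data.Rational.Unnormalised.Properties as ℚᵘ
open import Data.Fin.Properties using (_≟_; all?; injective⇒≤)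
open import Data.List using (List; []; _∷_; map; allFin; lookup)
import Data.List as List
open import Data.List.Extrema ℤ.≤-totalOrder using (max; ⊥≤max; v≤max⁺; argmax-all)
open import Data.List.Membership.Propositional using (_∈_; lose)
open import Data.List.Membership.Propositional.Properties using (∈-map⁺; ∈-allFin; ∈-lookup)
open import Data.List.Relation.Unary.All as All using ([])
open import Data.List.Relation.Unary.All.Properties using (map⁺; tabulate⁺; ¬Any⇒All¬)
open import Data.List.Relation.Unary.Any using (here; there)
open import Data.List.Relation.Unary.Unique.Propositional using (Unique; []; _∷_)
open import Data.Maybe using (nothing; maybe)
open import Data.Product using (∃₂; _,_; proj₁; proj₂)
open import Data.Sum using (_⊎_; inj₁; inj₂)
open import Function using (id; _∘_)
open import Function.Bundles using (_⇔_; mk⇔; Equivalence)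
import Function.Properties.Equivalence as ⇔
open import Function.Definitions using (Injective)
open import Relation.Binary.PropositionalEquality using (refl; trans; cong; cong₂; subst; subst₂; _≢_)
import Relation.Binary.PropositionalEquality as ≡
open import Relation.Nullary using (¬_; Dec; yes; no; contradiction)
open import Relation.Nullary.Decidable using (map′; _⊎-dec_; _×-dec_; _→-dec_)

open Equivalence using (to; from)

lookup-injective : ∀ {a} {A : Set a} {xs : List A} → Unique xs → Injective _≡_ _≡_ (lookup xs)
lookup-injective {xs = _ ∷ _} (_ ∷ _)    {Fin.zero}  {Fin.zero}  _  = refl
lookup-injective {xs = _ ∷ _} (x∉xs ∷ _) {Fin.zero}  {Fin.suc j} eq =
  contradiction eq (All.lookup x∉xs (∈-lookup j))
lookup-injective {xs = _ ∷ _} (x∉xs ∷ _) {Fin.suc i} {Fin.zero}  eq =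
  contradiction (≡.sym eq) (All.lookup x∉xs (∈-lookup i))
lookup-injective {xs = _ ∷ _} (_ ∷ u)    {Fin.suc i} {Fin.suc j} eq = cong Fin.suc (lookup-injective u eq)

unique⇒length≤ : ∀ {m} {xs : List (Fin m)} → Unique xs → List.length xs ≤ m
unique⇒length≤ u = injective⇒≤ (lookup-injective u)

_⇔-dec_ : ∀ {A B : Set} → Dec A → Dec B → Dec (A ⇔ B)
a? ⇔-dec b? = map′ (λ (f , g) → mk⇔ f g) (λ e → to e , from e) ((a? →-dec b?) ×-dec (b? →-dec a?))

module _ where
  open ℚ-Solver.+-*-Solver

  p≤∣p∣ : ∀ p → p ℚ.≤ ∣ p ∣
  p≤∣p∣ p with ℚ.∣p∣≡p∨∣p∣≡-p p
  ... | inj₁ ∣p∣≡p  = ℚ.≤-reflexive (≡.sym ∣p∣≡p)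
  ... | inj₂ ∣p∣≡-p = ℚ.≤-trans p≤0 (ℚ.0≤∣p∣ p)
    where
    p≤0 : p ℚ.≤ 0ℚ
    p≤0 = subst (ℚ._≤ 0ℚ) (solve 1 (λ p → :- (:- p) := p) refl p)
            (ℚ.neg-antimono-≤ (subst (0ℚ ℚ.≤_) ∣p∣≡-p (ℚ.0≤∣p∣ p)))

  ∣p∣≤r⇔ : ∀ {p r} → ∣ p ∣ ℚ.≤ r ⇔ (p ℚ.≤ r × ℚ.- p ℚ.≤ r)
  ∣p∣≤r⇔ {p} {r} = mk⇔
    (λ ∣p∣≤r → ℚ.≤-trans (p≤∣p∣ p) ∣p∣≤r ,
               ℚ.≤-trans (subst (ℚ.- p ℚ.≤_) (ℚ.∣-p∣≡∣p∣ p) (p≤∣p∣ (ℚ.- p))) ∣p∣≤r)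
    bound
    where
    bound : p ℚ.≤ r × ℚ.- p ℚ.≤ r → ∣ p ∣ ℚ.≤ r
    bound (p≤r , -p≤r) with ℚ.∣p∣≡p∨∣p∣≡-p p
    ... | inj₁ ∣p∣≡p  = subst (ℚ._≤ r) (≡.sym ∣p∣≡p) p≤r
    ... | inj₂ ∣p∣≡-p = subst (ℚ._≤ r) (≡.sym ∣p∣≡-p) -p≤r

  p-q≤r⇔p≤r+q : ∀ {p q r} → p ℚ.- q ℚ.≤ r ⇔ p ℚ.≤ r ℚ.+ q
  p-q≤r⇔p≤r+q {p} {q} {r} = mk⇔
    (λ h → subst (ℚ._≤ r ℚ.+ q) (solve 2 (λ p q → (p :- q) :+ q := p) refl p q) (ℚ.+-monoˡ-≤ q h))
    (λ h → subst (p ℚ.- q ℚ.≤_) (solve 2 (λ r q → (r :+ q) :- q := r) refl r q) (ℚ.+-monoˡ-≤ (ℚ.- q) h))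

  ∣p-q∣≤r⇔ : ∀ {p q r} → ∣ p ℚ.- q ∣ ℚ.≤ r ⇔ (p ℚ.≤ r ℚ.+ q × q ℚ.≤ r ℚ.+ p)
  ∣p-q∣≤r⇔ {p} {q} {r} = ⇔.trans ∣p∣≤r⇔ (mk⇔
    (λ (p-q≤r , -[p-q]≤r) →
       to p-q≤r⇔p≤r+q p-q≤r , to p-q≤r⇔p≤r+q (subst (ℚ._≤ r) -[p-q]≡q-p -[p-q]≤r))
    (λ (p≤r+q , q≤r+p) →
       from p-q≤r⇔p≤r+q p≤r+q , subst (ℚ._≤ r) (≡.sym -[p-q]≡q-p) (from p-q≤r⇔p≤r+q q≤r+p)))
    where
    -[p-q]≡q-p : ℚ.- (p ℚ.- q) ≡ q ℚ.- p
    -[p-q]≡q-p = solve 2 (λ p q → :- (p :- q) := q :- p) refl p q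

  r+p<q⇒p<-r+q : ∀ {p q r} → r ℚ.+ p ℚ.< q → p ℚ.< ℚ.- r ℚ.+ q
  r+p<q⇒p<-r+q {p} {q} {r} h =
    subst (ℚ._< ℚ.- r ℚ.+ q) (solve 2 (λ r p → :- r :+ (r :+ p) := p) refl r p) (ℚ.+-monoʳ-< (ℚ.- r) h)

  p≤r+p⇒0≤r : ∀ {p r} → p ℚ.≤ r ℚ.+ p → 0ℚ ℚ.≤ r
  p≤r+p⇒0≤r {p} {r} h =
    subst₂ ℚ._≤_ (ℚ.+-inverseʳ p) (solve 2 (λ r p → (r :+ p) :- p := r) refl r p) (ℚ.+-monoˡ-≤ (ℚ.- p) h)

  p<r+p⇒0<r : ∀ {p r} → p ℚ.< r ℚ.+ p → 0ℚ ℚ.< r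
  p<r+p⇒0<r {p} {r} h =
    subst₂ ℚ._<_ (ℚ.+-inverseʳ p) (solve 2 (λ r p → (r :+ p) :- p := r) refl r p) (ℚ.+-monoˡ-< (ℚ.- p) h)

  0≤1 : 0ℚ ℚ.≤ 1ℚ
  0≤1 = ℚ.toℚᵘ-cancel-≤ (*≤* (+≤+ z≤n))

  p<q⇒p≤r+q : ∀ {p q r} → 0ℚ ℚ.≤ r → p ℚ.< q → p ℚ.≤ r ℚ.+ q
  p<q⇒p≤r+q {p} {q} {r} 0≤r p<q =
    ℚ.≤-trans (ℚ.<⇒≤ p<q) (subst (ℚ._≤ r ℚ.+ q) (ℚ.+-identityˡ q) (ℚ.+-monoˡ-≤ q 0≤r))

-k+i≤j⇔i≤k+j : ∀ k i j → - k + i ℤ.≤ j ⇔ i ℤ.≤ k + j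
-k+i≤j⇔i≤k+j k i j = mk⇔
  (λ h → subst (ℤ._≤ k + j) (cancel k i) (ℤ.+-monoʳ-≤ k h))
  (λ h → subst (- k + i ℤ.≤_) (cancel′ k j) (ℤ.+-monoʳ-≤ (- k) h))
  where
  cancel : ∀ k i → k + (- k + i) ≡ i
  cancel = solve-∀
  cancel′ : ∀ k j → - k + (k + j) ≡ j
  cancel′ = solve-∀

private
  toℚᵘ-/ : ∀ z k → ℚ.toℚᵘ (z / suc k) ℚᵘ.≃ mkℚᵘ z k
  toℚᵘ-/ z k = ℚ.toℚᵘ-fromℚᵘ (mkℚᵘ z k)

module _ {k : ℕ} where

  /-mono-≤ : ∀ {a b} → a ℤ.≤ b → a / suc k ℚ.≤ b / suc k
  /-mono-≤ {a} {b} a≤b = ℚ.toℚᵘ-cancel-≤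
    (ℚᵘ.≤-respʳ-≃ (ℚᵘ.≃-sym (toℚᵘ-/ b k)) (ℚᵘ.≤-respˡ-≃ (ℚᵘ.≃-sym (toℚᵘ-/ a k))
      (*≤* (ℤ.*-monoʳ-≤-nonNeg (+ suc k) a≤b))))

  /-cancel-≤ : ∀ {a b} → a / suc k ℚ.≤ b / suc k → a ℤ.≤ b
  /-cancel-≤ {a} {b} a/≤b/
    with ℚᵘ.≤-respʳ-≃ (toℚᵘ-/ b k) (ℚᵘ.≤-respˡ-≃ (toℚᵘ-/ a k) (ℚ.toℚᵘ-mono-≤ a/≤b/))
  ... | *≤* a*d≤b*d = ℤ.*-cancelʳ-≤-pos a b (+ suc k) a*d≤b*d

  /-mono-< : ∀ {a b} → a ℤ.< b → a / suc k ℚ.< b / suc k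
  /-mono-< {a} {b} a<b = ℚ.toℚᵘ-cancel-<
    (ℚᵘ.<-respʳ-≃ (ℚᵘ.≃-sym (toℚᵘ-/ b k)) (ℚᵘ.<-respˡ-≃ (ℚᵘ.≃-sym (toℚᵘ-/ a k))
      (*<* (ℤ.*-monoʳ-<-pos (+ suc k) a<b))))

  /-cancel-< : ∀ {a b} → a / suc k ℚ.< b / suc k → a ℤ.< b
  /-cancel-< {a} {b} a/<b/
    with ℚᵘ.<-respʳ-≃ (toℚᵘ-/ b k) (ℚᵘ.<-respˡ-≃ (toℚᵘ-/ a k) (ℚ.toℚᵘ-mono-< a/<b/))
  ... | *<* a*d<b*d = ℤ.*-cancelʳ-<-nonNeg (+ suc k) a*d<b*d

  d/d≡1 : + suc k / suc k ≡ 1ℚ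
  d/d≡1 = ℚ.toℚᵘ-injective (ℚᵘ.≃-trans (toℚᵘ-/ (+ suc k) k) (*≡* (ℤ.*-comm (+ suc k) (+ 1))))

  /1*ε≡/ : ∀ z → (z / 1) ℚ.* ε (suc k) ≡ z / suc k
  /1*ε≡/ z = ℚ.toℚᵘ-injective (ℚᵘ.≃-trans (ℚ.toℚᵘ-homo-* (z / 1) (+ 1 / suc k))
    (ℚᵘ.≃-trans (ℚᵘ.*-cong (toℚᵘ-/ z 0) (toℚᵘ-/ (+ 1) k))
      (ℚᵘ.≃-trans (*≡* cross) (ℚᵘ.≃-sym (toℚᵘ-/ z k)))))
    where
    cross : (z * + 1) * + suc k ≡ z * + suc (k ℕ.+ 0)
    cross rewrite ℕ.+-identityʳ k = cong (_* + suc k) (ℤ.*-identityʳ z)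

/1-homo-+ : ∀ a b → (a + b) / 1 ≡ a / 1 ℚ.+ b / 1
/1-homo-+ a b = ℚ.toℚᵘ-injective (ℚᵘ.≃-trans (toℚᵘ-/ (a + b) 0) (ℚᵘ.≃-sym
  (ℚᵘ.≃-trans (ℚ.toℚᵘ-homo-+ (a / 1) (b / 1))
    (ℚᵘ.≃-trans (ℚᵘ.+-cong (toℚᵘ-/ a 0) (toℚᵘ-/ b 0)) (*≡* (cross a b))))))
  where
  cross : ∀ a b → (a * + 1 + b * + 1) * + 1 ≡ (a + b) * + 1
  cross = solve-∀

/-homo-+ : ∀ {k} a b → (a + b) / suc k ≡ a / suc k ℚ.+ b / suc k
/-homo-+ {k} a b = begin
  (a + b) / suc k                                 ≡⟨ /1*ε≡/ (a + b) ⟨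
  ((a + b) / 1) ℚ.* ε (suc k)                     ≡⟨ cong (ℚ._* ε (suc k)) (/1-homo-+ a b) ⟩
  (a / 1 ℚ.+ b / 1) ℚ.* ε (suc k)                   ≡⟨ ℚ.*-distribʳ-+ (ε (suc k)) (a / 1) (b / 1) ⟩
  (a / 1) ℚ.* ε (suc k) ℚ.+ (b / 1) ℚ.* ε (suc k)   ≡⟨ cong₂ ℚ._+_ (/1*ε≡/ a) (/1*ε≡/ b) ⟩
  a / suc k ℚ.+ b / suc k                           ∎
  where open ≡.≡-Reasoning

ceiling-div : ∀ m d .{{_ : ℕ.NonZero d}} → ∃ λ c → ∀ z → m ℤ.≤ z * + d ⇔ c ℤ.≤ z
ceiling-div m d = - (- m /ℕ d) , λ z → mk⇔ (least z) (above z)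
  where
  open ℤ.≤-Reasoning
  least : ∀ z → m ℤ.≤ z * + d → - (- m /ℕ d) ℤ.≤ z
  least z m≤zd = ℤ.neg-cancel-≤ (begin
    - z                       ≤⟨ ℤ.i<j⇒i≤pred[j] unscaled ⟩
    ℤ.pred (ℤ.suc (- m /ℕ d)) ≡⟨ ℤ.pred-suc _ ⟩
    - m /ℕ d                  ≡⟨ ℤ.neg-involutive _ ⟨
    - - (- m /ℕ d)        ∎)
    where
    scaled : - z * + d ℤ.< ℤ.suc (- m /ℕ d) * + d
    scaled = begin-strict
      - z * + d              ≡⟨ ℤ.neg-distribˡ-* z (+ d) ⟨
      - (z * + d)            ≤⟨ ℤ.neg-mono-≤ m≤zd ⟩
      - m                      <⟨ n<s[n/ℕd]*d (- m) d ⟩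
      ℤ.suc (- m /ℕ d) * + d ∎
    unscaled : - z ℤ.< ℤ.suc (- m /ℕ d)
    unscaled = ℤ.*-cancelʳ-<-nonNeg (+ d) scaled
  above : ∀ z → - (- m /ℕ d) ℤ.≤ z → m ℤ.≤ z * + d
  above z c≤z = begin
    m                         ≡⟨ ℤ.neg-involutive m ⟨
    - - m                 ≤⟨ ℤ.neg-mono-≤ ([n/ℕd]*d≤n (- m) d) ⟩
    - ((- m /ℕ d) * + d) ≡⟨ ℤ.neg-distribˡ-* (- m /ℕ d) (+ d) ⟩
    - (- m /ℕ d) * + d  ≤⟨ ℤ.*-monoʳ-≤-nonNeg (+ d) c≤z ⟩
    z * + d                 ∎

ceiling-/ : ∀ (q : ℚ) k → ∃ λ c → ∀ z → q ℚ.≤ z / suc k ⇔ c ℤ.≤ z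
ceiling-/ q@(mkℚ num den-1 _) k with ceiling-div (num * + suc k) (suc den-1)
... | c , spec = c , λ z → mk⇔
  (λ q≤z/d → to (spec z) (toℤ (ℚᵘ.≤-respʳ-≃ (toℚᵘ-/ z k) (ℚ.toℚᵘ-mono-≤ q≤z/d))))
  (λ c≤z → ℚ.toℚᵘ-cancel-≤ (ℚᵘ.≤-respʳ-≃ (ℚᵘ.≃-sym (toℚᵘ-/ z k)) (*≤* (from (spec z) c≤z))))
  where
  toℤ : ∀ {z} → mkℚᵘ num den-1 ℚᵘ.≤ mkℚᵘ z k → num * + suc k ℤ.≤ z * + suc den-1
  toℤ (*≤* h) = h

module DifferenceConstraints {n : ℕ} (W : Fin n → Fin n → Maybe ℤ) where

  open import Data.List.Membership.DecPropositional (_≟_ {n}) using (_∈?_)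

  Solution : (Fin n → ℤ) → Set
  Solution x = ∀ {u v w} → W u v ≡ just w → w + x u ℤ.≤ x v

  data Walk : Fin n → Fin n → Set where
    []   : ∀ {s} → Walk s s
    snoc : ∀ {s u v} → Walk s u → (w : ℤ) → W u v ≡ just w → Walk s v

  weight : ∀ {s t} → Walk s t → ℤ
  weight []           = 0ℤ
  weight (snoc c w _) = w + weight c

  length : ∀ {s t} → Walk s t → ℕ
  length []           = 0
  length (snoc c _ _) = suc (length c)

  vertices : ∀ {s t} → Walk s t → List (Fin n)
  vertices {s} []               = s ∷ []
  vertices {t = v} (snoc c _ _) = v ∷ vertices c

  Simple : ∀ {s t} → Walk s t → Set
  Simple c = Unique (vertices c)

  simple-length< : ∀ {s t} {c : Walk s t} → Simple c → length c < n
  simple-length< {c = c} simple = subst (ℕ._≤ n) (length-vertices c) (unique⇒length≤ simple)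
    where
    length-vertices : ∀ {s t} (c : Walk s t) → List.length (vertices c) ≡ suc (length c)
    length-vertices []           = refl
    length-vertices (snoc c _ _) = cong suc (length-vertices c)

  splitAt : ∀ {s t v} (c : Walk s t) → Simple c → v ∈ vertices c →
            ∃₂ λ (p : Walk s v) (q : Walk v t) →
              Simple p × weight c ≡ weight q + weight p × length q ≤ length c
  splitAt []           simple (here refl) = [] , [] , simple , refl , z≤n
  splitAt (snoc c w e) simple (here refl) = snoc c w e , [] , simple , ≡.sym (ℤ.+-identityˡ _) , z≤n
  splitAt (snoc c w e) (_ ∷ simple) (there v∈c) with splitAt c simple v∈c
  ... | p , q , simple-p , c≡q+p , q≤c =
    p , snoc q w e , simple-p , trans (cong (_+_ w) c≡q+p) (≡.sym (ℤ.+-assoc w (weight q) (weight p))) , s≤s q≤c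

  NoPositiveCycles : Set
  NoPositiveCycles = ∀ {v} (c : Walk v v) → length c ≤ n → weight c ℤ.≤ 0ℤ

  record LeastSolutionAbove (lower : Fin n → ℤ) : Set where
    field
      point    : Fin n → ℤ
      solution : Solution point
      above    : ∀ v → lower v ℤ.≤ point v
      least    : ∀ x → Solution x → (∀ v → lower v ℤ.≤ x v) → ∀ v → point v ℤ.≤ x v

  module BellmanFord (noPositiveCycles : NoPositiveCycles) (lower : Fin n → ℤ) where

    -- Non-edges contribute d v itself, which leaves the maximum unchanged.
    candidate : (Fin n → ℤ) → Fin n → Fin n → ℤ
    candidate d v u = maybe (_+ d u) (d v) (W u v)

    relax : (Fin n → ℤ) → Fin n → ℤ
    relax d v = max (d v) (map (candidate d v) (allFin n))

    relax-induction : ∀ (P : ℤ → Set) {d v} → P (d v) →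
                      (∀ {u w} → W u v ≡ just w → P (w + d u)) → P (relax d v)
    relax-induction P {d} {v} base edge = argmax-all id {P = P} base (map⁺ (tabulate⁺ candidate-P))
      where
      candidate-P : ∀ u → P (candidate d v u)
      candidate-P u with W u v in e
      ... | just w  = edge e
      ... | nothing = base

    relax-≥ : ∀ d v → d v ℤ.≤ relax d v
    relax-≥ d v = ⊥≤max (d v) (map (candidate d v) (allFin n))

    relax-≥-edge : ∀ d {u v w} → W u v ≡ just w → w + d u ℤ.≤ relax d v
    relax-≥-edge d {u} {v} e = v≤max⁺ (d v) (map (candidate d v) (allFin n))
      (inj₂ (lose (∈-map⁺ (candidate d v) (∈-allFin u)) (ℤ.≤-reflexive (≡.sym (cong (maybe (_+ d u) (d v)) e)))))

    relax-attained : ∀ d v → relax d v ≡ d v ⊎ ∃₂ λ u w → W u v ≡ just w × relax d v ≡ w + d u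
    relax-attained d v = relax-induction (λ r → r ≡ d v ⊎ ∃₂ λ u w → W u v ≡ just w × r ≡ w + d u)
                                         (inj₁ refl) (λ e → inj₂ (_ , _ , e , refl))

    iterate : ℕ → Fin n → ℤ
    iterate zero    = lower
    iterate (suc t) = relax (iterate t)

    lower≤iterate : ∀ t v → lower v ℤ.≤ iterate t v
    lower≤iterate zero    v = ℤ.≤-refl
    lower≤iterate (suc t) v = ℤ.≤-trans (lower≤iterate t v) (relax-≥ (iterate t) v)

    value : ∀ {s v} → Walk s v → ℤ
    value {s} c = weight c + lower s

    value≤iterate : ∀ {s v} (c : Walk s v) t → length c ≤ t → value c ℤ.≤ iterate t v
    value≤iterate {s} [] t _ = subst (ℤ._≤ iterate t s) (≡.sym (ℤ.+-identityˡ _)) (lower≤iterate t s)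
    value≤iterate {s} (snoc c w e) (suc t) (s≤s c≤t) = begin
      (w + weight c) + lower s ≡⟨ ℤ.+-assoc w (weight c) (lower s) ⟩
      w + value c              ≤⟨ ℤ.+-monoʳ-≤ w (value≤iterate c t c≤t) ⟩
      w + iterate t _          ≤⟨ relax-≥-edge (iterate t) e ⟩
      iterate (suc t) _        ∎
      where open ℤ.≤-Reasoning

    -- Shortcutting the cycle closed by the last step does not decrease the value.
    simple-dominates : ∀ t v → ∃₂ λ s (c : Walk s v) → Simple c × iterate t v ℤ.≤ value c
    simple-dominates zero v = v , [] , [] ∷ [] , ℤ.≤-reflexive (≡.sym (ℤ.+-identityˡ _))
    simple-dominates (suc t) v with relax-attained (iterate t) v
    ... | inj₁ unchanged =
      let s , c , simple , bound = simple-dominates t v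
      in  s , c , simple , subst (ℤ._≤ value c) (≡.sym unchanged) bound
    ... | inj₂ (u , w , e , relaxed) =
      let s , c , simple , bound = simple-dominates t u
      in  subst (λ r → ∃₂ λ s (c : Walk s v) → Simple c × r ℤ.≤ value c) (≡.sym relaxed)
                (extend c simple (ℤ.+-monoʳ-≤ w bound))
      where
      extend : ∀ {s} (c : Walk s u) → Simple c → ∀ {r} → r ℤ.≤ w + value c →
               ∃₂ λ s (c′ : Walk s v) → Simple c′ × r ℤ.≤ value c′
      extend {s} c simple {r} r≤ with v ∈? vertices c
      ... | no v∉c = s , snoc c w e , ¬Any⇒All¬ (vertices c) v∉c ∷ simple ,
                     ℤ.≤-trans r≤ (ℤ.≤-reflexive (≡.sym (ℤ.+-assoc w (weight c) (lower s))))
      ... | yes v∈c =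
        let p , q , simple-p , c≡q+p , q≤c = splitAt c simple v∈c
            cycle≤0 = noPositiveCycles (snoc q w e) (ℕ.≤-trans (s≤s q≤c) (simple-length< simple))
        in  s , p , simple-p , (begin
          r                                        ≤⟨ r≤ ⟩
          w + (weight c + lower s)                 ≡⟨ cong (λ x → w + (x + lower s)) c≡q+p ⟩
          w + ((weight q + weight p) + lower s)    ≡⟨ cong (_+_ w) (ℤ.+-assoc (weight q) (weight p) (lower s)) ⟩
          w + (weight q + value p)                 ≡⟨ ℤ.+-assoc w (weight q) (value p) ⟨
          (w + weight q) + value p                 ≤⟨ ℤ.+-monoˡ-≤ (value p) cycle≤0 ⟩
          0ℤ + value p                             ≡⟨ ℤ.+-identityˡ _ ⟩
          value p                                  ∎)
        where open ℤ.≤-Reasoning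

    stable : ∀ v → relax (iterate n) v ℤ.≤ iterate n v
    stable v with simple-dominates (suc n) v
    ... | s , c , simple , bound = ℤ.≤-trans bound (value≤iterate c n (ℕ.<⇒≤ (simple-length< simple)))

    iterate-least : ∀ x → Solution x → (∀ v → lower v ℤ.≤ x v) → ∀ t v → iterate t v ℤ.≤ x v
    iterate-least x sol lower≤x zero    v = lower≤x v
    iterate-least x sol lower≤x (suc t) v =
      relax-induction (ℤ._≤ x v) (iterate-least x sol lower≤x t v)
        (λ {u} {w} e → ℤ.≤-trans (ℤ.+-monoʳ-≤ w (iterate-least x sol lower≤x t u)) (sol e))

    leastSolution : LeastSolutionAbove lower
    leastSolution = record
      { point    = iterate n
      ; solution = λ e → ℤ.≤-trans (relax-≥-edge (iterate n) e) (stable _)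
      ; above    = lower≤iterate n
      ; least    = λ x sol lower≤x → iterate-least x sol lower≤x n
      }

  module Certified (K : ℕ) (p : Fin n → ℚ) where

    data Certificate (u v : Fin n) (w : ℤ) : Set where
      nonstrict : ∀ b → w ≡ - (+ K * b) → p u ℚ.≤ b / 1 ℚ.+ p v → Certificate u v w
      strict    : ∀ b → w ≡ + 1 - + K * b → p u ℚ.< b / 1 ℚ.+ p v → Certificate u v w

    record WalkCertificate {s t} (c : Walk s t) : Set where
      field
        strictSteps        : ℕ
        shift              : ℤ
        strictSteps≤length : strictSteps ≤ length c
        weight≡            : weight c ≡ + strictSteps - + K * shift
        potential-≤        : p s ℚ.≤ shift / 1 ℚ.+ p t
        potential-<        : 0 < strictSteps → p s ℚ.< shift / 1 ℚ.+ p t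

    private
      regroup : ∀ B b q → B / 1 ℚ.+ (b / 1 ℚ.+ q) ≡ (B + b) / 1 ℚ.+ q
      regroup B b q = trans (≡.sym (ℚ.+-assoc (B / 1) (b / 1) q)) (cong (ℚ._+ q) (≡.sym (/1-homo-+ B b)))

    certify : (∀ {u v w} → W u v ≡ just w → Certificate u v w) → ∀ {s t} (c : Walk s t) → WalkCertificate c
    certify cert {s} [] = record
      { strictSteps = 0 ; shift = 0ℤ ; strictSteps≤length = z≤n
      ; weight≡ = no-steps (+ K)
      ; potential-≤ = ℚ.≤-reflexive (≡.sym (ℚ.+-identityˡ (p s)))
      ; potential-< = λ ()
      }
      where
      no-steps : ∀ k → 0ℤ ≡ + 0 - k * 0ℤ
      no-steps = solve-∀
    certify cert {s} (snoc {u = u} {v = v} c w e) with certify cert c | cert e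
    ... | γ | nonstrict b w≡ pu≤ = record
      { strictSteps = A ; shift = B + b ; strictSteps≤length = ℕ.m≤n⇒m≤1+n A≤
      ; weight≡ = trans (cong₂ _+_ w≡ weight≡) (add-nonstrict (+ A) (+ K) b B)
      ; potential-≤ = begin
          p s                       ≤⟨ potential-≤ ⟩
          B / 1 ℚ.+ p u             ≤⟨ ℚ.+-monoʳ-≤ (B / 1) pu≤ ⟩
          B / 1 ℚ.+ (b / 1 ℚ.+ p v) ≡⟨ regroup B b (p v) ⟩
          (B + b) / 1 ℚ.+ p v       ∎
      ; potential-< = λ 0<A → begin-strict
          p s                       <⟨ potential-< 0<A ⟩
          B / 1 ℚ.+ p u             ≤⟨ ℚ.+-monoʳ-≤ (B / 1) pu≤ ⟩
          B / 1 ℚ.+ (b / 1 ℚ.+ p v) ≡⟨ regroup B b (p v) ⟩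
          (B + b) / 1 ℚ.+ p v       ∎
      }
      where
      open WalkCertificate γ renaming (strictSteps to A; shift to B; strictSteps≤length to A≤)
      open ℚ.≤-Reasoning
      add-nonstrict : ∀ a k b B → - (k * b) + (a - k * B) ≡ a - k * (B + b)
      add-nonstrict = solve-∀
    ... | γ | strict b w≡ pu< = record
      { strictSteps = suc A ; shift = B + b ; strictSteps≤length = s≤s A≤
      ; weight≡ = trans (cong₂ _+_ w≡ weight≡) (add-strict (+ A) (+ K) b B)
      ; potential-≤ = ℚ.<⇒≤ p-shift
      ; potential-< = λ _ → p-shift
      }
      where
      open WalkCertificate γ renaming (strictSteps to A; shift to B; strictSteps≤length to A≤)
      open ℚ.≤-Reasoning
      add-strict : ∀ a k b B → (+ 1 - k * b) + (a - k * B) ≡ (+ 1 + a) - k * (B + b)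
      add-strict = solve-∀
      p-shift : p s ℚ.< (B + b) / 1 ℚ.+ p v
      p-shift = begin-strict
          p s                       ≤⟨ potential-≤ ⟩
          B / 1 ℚ.+ p u             <⟨ ℚ.+-monoʳ-< (B / 1) pu< ⟩
          B / 1 ℚ.+ (b / 1 ℚ.+ p v) ≡⟨ regroup B b (p v) ⟩
          (B + b) / 1 ℚ.+ p v       ∎

    private
      k≤n*b : ∀ {k n b} → k ≤ n → 0ℤ ℤ.≤ b → (0 < k → 0ℤ ℤ.< b) → + k ℤ.≤ + n * b
      k≤n*b {zero}  {n} _   0≤b _   = subst (ℤ._≤ + n * _) (ℤ.*-zeroʳ (+ n)) (ℤ.*-monoˡ-≤-nonNeg (+ n) 0≤b)
      k≤n*b {suc k} {n} k≤n _   0<b = ℤ.≤-trans (+≤+ k≤n) (subst (ℤ._≤ + n * _) (ℤ.*-identityʳ (+ n))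
        (ℤ.*-monoˡ-≤-nonNeg (+ n) (ℤ.i<j⇒suc[i]≤j (0<b (s≤s z≤n)))))

    certified-cycle≤0 : (∀ {u v w} → W u v ≡ just w → Certificate u v w) →
                        ∀ {v} (c : Walk v v) → length c ≤ K → weight c ℤ.≤ 0ℤ
    certified-cycle≤0 cert {v} c c≤K =
      subst (ℤ._≤ 0ℤ) (≡.sym weight≡)
        (ℤ.i≤j⇒i-j≤0 (k≤n*b (ℕ.≤-trans strictSteps≤length c≤K) 0≤shift 0<shift))
      where
      open WalkCertificate (certify cert c)
      0≤shift : 0ℤ ℤ.≤ shift
      0≤shift = /-cancel-≤ (p≤r+p⇒0≤r potential-≤)
      0<shift : 0 < strictSteps → 0ℤ ℤ.< shift
      0<shift 0<A = /-cancel-< (p<r+p⇒0<r (potential-< 0<A))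

module OrderConstraints {n : ℕ} (G : Graph n) {_≺_ : Fin n → Fin n → Set} (order : AdmissibleOrder G _≺_)
                        (K : ℕ) where

  private
    module O = AdmissibleOrder order
    ℓʳ : Positions n
    ℓʳ = proj₁ O.realized
    ℓʳ-rep : IsUnitIntervalRep G ℓʳ
    ℓʳ-rep = proj₁ (proj₂ O.realized)
    ℓʳ-order : ∀ u v → u ≺ v → ℓʳ u ℚ.< ℓʳ v
    ℓʳ-order = proj₂ (proj₂ O.realized)

  adjacent⇒≢ : ∀ {u v} → Adj G u v → u ≢ v
  adjacent⇒≢ a refl = irrefl G a

  ≺⇒≢ : ∀ {u v} → u ≺ v → u ≢ v
  ≺⇒≢ u≺v refl = O.irrefl u≺v

  ≺-asym : ∀ {u v} → u ≺ v → ¬ v ≺ u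
  ≺-asym u≺v v≺u = O.irrefl (O.trans u≺v v≺u)

  adjacent? : ∀ u v → Dec (Adj G u v)
  adjacent? u v with u ≟ v
  ... | yes refl = no (irrefl G)
  ... | no u≢v   =
    map′ (from (ℓʳ-rep u v u≢v)) (to (ℓʳ-rep u v u≢v)) (∣ ℓʳ u ℚ.- ℓʳ v ∣ ℚ.≤? 1ℚ)

  indistinguishable? : ∀ u v → Dec (Indist G u v)
  indistinguishable? u v = all? λ w → closed? u w ⇔-dec closed? v w
    where
    closed? : ∀ u w → Dec (InClosedNbhd G u w)
    closed? u w = (w ≟ u) ⊎-dec adjacent? u w

  _≺?_ : ∀ u v → Dec (u ≺ v)
  u ≺? v with u ≟ v
  ... | yes refl = no O.irrefl
  ... | no u≢v with indistinguishable? u v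
  ...   | yes indist = no λ u≺v → to (O.compar u v u≢v) (inj₁ u≺v) indist
  ...   | no distinct with from (O.compar u v u≢v) distinct
  ...     | inj₁ u≺v = yes u≺v
  ...     | inj₂ v≺u = no (≺-asym v≺u)

  -- Distinct vertices that are not adjacent have different closed neighbourhoods, hence are comparable.
  incomparable⇒adjacent : ∀ {u v} → u ≢ v → ¬ u ≺ v → ¬ v ≺ u → Adj G u v
  incomparable⇒adjacent {u} {v} u≢v u⊀v v⊀u with adjacent? u v
  ... | yes a = a
  ... | no ¬a with from (O.compar u v u≢v) distinguishable
    where
    distinguishable : ¬ Indist G u v
    distinguishable indist with from (indist v) (inj₁ refl)
    ... | inj₁ v≡u = u≢v (≡.sym v≡u)
    ... | inj₂ a   = ¬a a
  ...   | inj₁ u≺v = contradiction u≺v u⊀v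
  ...   | inj₂ v≺u = contradiction v≺u v⊀u

  data Constraint (u v : Fin n) : ℤ → Set where
    adjacent-before : u ≺ v → Adj G u v → Constraint u v (+ 1)
    apart-before    : u ≺ v → ¬ Adj G u v → Constraint u v (+ suc K)
    adjacent        : ¬ u ≺ v → Adj G u v → Constraint u v (- + K)

  constraint : Fin n → Fin n → Maybe ℤ
  constraint u v with u ≺? v | adjacent? u v
  ... | yes _ | yes _ = just (+ 1)
  ... | yes _ | no _  = just (+ suc K)
  ... | no _  | yes _ = just (- + K)
  ... | no _  | no _  = nothing

  constraint-sound : ∀ {u v w} → constraint u v ≡ just w → Constraint u v w
  constraint-sound {u} {v} e with u ≺? v | adjacent? u v
  constraint-sound refl | yes u≺v | yes a = adjacent-before u≺v a
  constraint-sound refl | yes u≺v | no ¬a = apart-before u≺v ¬a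
  constraint-sound refl | no u⊀v  | yes a = adjacent u⊀v a

  constraint-complete : ∀ {u v w} → Constraint u v w → constraint u v ≡ just w
  constraint-complete {u} {v} c with u ≺? v | adjacent? u v | c
  ... | yes _   | yes _ | adjacent-before _ _   = refl
  ... | yes _   | no _  | apart-before _ _      = refl
  ... | no _    | yes _ | adjacent _ _          = refl
  ... | yes _   | no ¬a | adjacent-before _ a   = contradiction a ¬a
  ... | yes _   | yes a | apart-before _ ¬a     = contradiction a ¬a
  ... | no _    | no ¬a | adjacent _ a          = contradiction a ¬a
  ... | no u⊀v  | _     | adjacent-before u≺v _ = contradiction u≺v u⊀v
  ... | no u⊀v  | _     | apart-before u≺v _    = contradiction u≺v u⊀v
  ... | yes u≺v | _     | adjacent u⊀v _        = contradiction u≺v u⊀v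

  Close : ℤ → ℤ → Set
  Close a b = a ℤ.≤ + K + b × b ℤ.≤ + K + a

  IntegerRep : (Fin n → ℤ) → Set
  IntegerRep x = (∀ u v → u ≢ v → (Adj G u v ⇔ Close (x u) (x v))) × (∀ u v → u ≺ v → x u ℤ.< x v)

  open DifferenceConstraints constraint

  private
    apart⇔ : ∀ i j → + suc K + i ℤ.≤ j ⇔ + K + i ℤ.< j
    apart⇔ i j = mk⇔
      (λ h → ℤ.suc[i]≤j⇒i<j (subst (ℤ._≤ j) (ℤ.+-assoc (+ 1) (+ K) i) h))
      (λ h → subst (ℤ._≤ j) (≡.sym (ℤ.+-assoc (+ 1) (+ K) i)) (ℤ.i<j⇒suc[i]≤j h))

  module _ {x : Fin n → ℤ} (sol : Solution x) where

    solution-before : ∀ {u v} → u ≺ v → x u ℤ.< x v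
    solution-before {u} {v} u≺v with adjacent? u v
    ... | yes a = ℤ.suc[i]≤j⇒i<j (sol (constraint-complete (adjacent-before u≺v a)))
    ... | no ¬a = ℤ.≤-<-trans (ℤ.i≤j+i (x u) (+ K))
                    (to (apart⇔ (x u) (x v)) (sol (constraint-complete (apart-before u≺v ¬a))))

    solution-adjacent : ∀ {u v} → Adj G u v → x v ℤ.≤ + K + x u
    solution-adjacent {u} {v} a with v ≺? u
    ... | yes v≺u = ℤ.i≤j⇒i≤k+j (+ K) (ℤ.<⇒≤ (solution-before v≺u))
    ... | no v⊀u  = to (-k+i≤j⇔i≤k+j (+ K) (x v) (x u)) (sol (constraint-complete (adjacent v⊀u (sym G a))))

    solution-apart : ∀ {u v} → u ≢ v → ¬ Adj G u v → ¬ Close (x u) (x v)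
    solution-apart {u} {v} u≢v ¬a (xu≤ , xv≤) with u ≺? v | v ≺? u
    ... | yes u≺v | _       =
      ℤ.<⇒≱ (to (apart⇔ (x u) (x v)) (sol (constraint-complete (apart-before u≺v ¬a)))) xv≤
    ... | no _    | yes v≺u =
      ℤ.<⇒≱ (to (apart⇔ (x v) (x u)) (sol (constraint-complete (apart-before v≺u (¬a ∘ sym G))))) xu≤
    ... | no u⊀v  | no v⊀u  = ¬a (incomparable⇒adjacent u≢v u⊀v v⊀u)

    solution⇒integerRep : IntegerRep x
    solution⇒integerRep =
      (λ u v u≢v → mk⇔ (λ a → solution-adjacent (sym G a) , solution-adjacent a) (adjacent-if-close u≢v)) ,
      (λ u v → solution-before)
      where
      adjacent-if-close : ∀ {u v} → u ≢ v → Close (x u) (x v) → Adj G u v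
      adjacent-if-close {u} {v} u≢v close with adjacent? u v
      ... | yes a = a
      ... | no ¬a = contradiction close (solution-apart u≢v ¬a)

  integerRep⇒solution : ∀ {x} → IntegerRep x → Solution x
  integerRep⇒solution {x} (adjacency , before) {u} {v} e with constraint-sound e
  ... | adjacent-before u≺v _ = ℤ.i<j⇒suc[i]≤j (before _ _ u≺v)
  ... | apart-before u≺v ¬a = from (apart⇔ (x u) (x v)) (ℤ.≰⇒> λ xv≤ →
        ¬a (from (adjacency _ _ (≺⇒≢ u≺v)) (ℤ.i≤j⇒i≤k+j (+ K) (ℤ.<⇒≤ (before _ _ u≺v)) , xv≤)))
  ... | adjacent _ a = from (-k+i≤j⇔i≤k+j (+ K) (x u) (x v)) (proj₁ (to (adjacency _ _ (adjacent⇒≢ a)) a))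

  open Certified K ℓʳ

  constraint-certified : ∀ {u v w} → constraint u v ≡ just w → Certificate u v w
  constraint-certified {u} {v} e with constraint-sound e
  ... | adjacent-before u≺v _ =
    strict 0ℤ (forward-weight (+ K)) (subst (ℓʳ u ℚ.<_) (≡.sym (ℚ.+-identityˡ (ℓʳ v))) (ℓʳ-order u v u≺v))
    where
    forward-weight : ∀ k → + 1 ≡ + 1 - k * 0ℤ
    forward-weight = solve-∀
  ... | apart-before u≺v ¬a = strict -[1+ 0 ] (apart-weight (+ K)) (r+p<q⇒p<-r+q {r = 1ℚ} (ℚ.≰⇒> far))
    where
    apart-weight : ∀ k → + 1 + k ≡ + 1 - k * -[1+ 0 ]
    apart-weight = solve-∀
    far : ¬ ℓʳ v ℚ.≤ 1ℚ ℚ.+ ℓʳ u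
    far v≤ = ¬a (from (ℓʳ-rep u v (≺⇒≢ u≺v))
                  (from ∣p-q∣≤r⇔ (p<q⇒p≤r+q 0≤1 (ℓʳ-order u v u≺v) , v≤)))
  ... | adjacent _ a = nonstrict (+ 1) (cong -_ (≡.sym (ℤ.*-identityʳ (+ K))))
                         (proj₁ (to ∣p-q∣≤r⇔ (to (ℓʳ-rep u v (adjacent⇒≢ a)) a)))

  noPositiveCycles : n ≤ K → NoPositiveCycles
  noPositiveCycles n≤K c c≤n = certified-cycle≤0 constraint-certified c (ℕ.≤-trans c≤n n≤K)

module GridRepresentations {n : ℕ} (G : Graph n) {_≺_ : Fin n → Fin n → Set} (order : AdmissibleOrder G _≺_)
                           (k : ℕ) where

  K : ℕ
  K = suc k

  open OrderConstraints G order K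

  _≗_/K : Positions n → (Fin n → ℤ) → Set
  ℓ ≗ x /K = ∀ v → ℓ v ≡ x v / K

  1+/K : ∀ b → 1ℚ ℚ.+ b / K ≡ (+ K + b) / K
  1+/K b = ≡.sym (trans (/-homo-+ (+ K) b) (cong (ℚ._+ b / K) (d/d≡1 {k})))

  close⇔ : ∀ a b → ∣ a / K ℚ.- b / K ∣ ℚ.≤ 1ℚ ⇔ Close a b
  close⇔ a b = ⇔.trans ∣p-q∣≤r⇔ (mk⇔
    (λ (a≤ , b≤) → /-cancel-≤ (subst (a / K ℚ.≤_) (1+/K b) a≤) ,
                   /-cancel-≤ (subst (b / K ℚ.≤_) (1+/K a) b≤))
    (λ (a≤ , b≤) → subst (a / K ℚ.≤_) (≡.sym (1+/K b)) (/-mono-≤ a≤) ,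
                   subst (b / K ℚ.≤_) (≡.sym (1+/K a)) (/-mono-≤ b≤)))

  gridRep⇔ : ∀ {ℓ x} → ℓ ≗ x /K →
             (IsUnitIntervalRep G ℓ × (∀ u v → u ≺ v → ℓ u ℚ.< ℓ v)) ⇔ IntegerRep x
  gridRep⇔ {ℓ} {x} ℓ≡ = mk⇔
    (λ (rep , before) → (λ u v u≢v → ⇔.trans (rep u v u≢v) (adjacency u v)) ,
                        (λ u v u≺v → /-cancel-< (subst₂ ℚ._<_ (ℓ≡ u) (ℓ≡ v) (before u v u≺v))))
    (λ (adj , before) → (λ u v u≢v → ⇔.trans (adj u v u≢v) (⇔.sym (adjacency u v))) ,
                        (λ u v u≺v → subst₂ ℚ._<_ (≡.sym (ℓ≡ u)) (≡.sym (ℓ≡ v)) (/-mono-< (before u v u≺v))))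
    where
    adjacency : ∀ u v → ∣ ℓ u ℚ.- ℓ v ∣ ℚ.≤ 1ℚ ⇔ Close (x u) (x v)
    adjacency u v rewrite ℓ≡ u | ℓ≡ v = close⇔ (x u) (x v)

  onGrid : (Fin n → ℤ) → Positions n
  onGrid x v = (x v / 1) ℚ.* ε K

  onGrid≡ : ∀ x → onGrid x ≗ x /K
  onGrid≡ x v = /1*ε≡/ (x v)

  hops : ∀ {u v} → Reach G u v → ℕ
  hops here       = 0
  hops (step _ r) = suc (hops r)

  spread : ∀ {x} → IntegerRep x → ∀ {u v} (r : Reach G u v) → - (+ K * + hops r) + x u ℤ.≤ x v
  spread {x} _ {u} here = ℤ.≤-reflexive (no-hops (+ K) (x u))
    where
    no-hops : ∀ k a → - (k * + 0) + a ≡ a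
    no-hops = solve-∀
  spread {x} rep {u} {v} (step {w = w} a r) = begin
    - (+ K * + suc (hops r)) + x u     ≡⟨ one-more-hop (+ K) (+ hops r) (x u) ⟩
    - (+ K * + hops r) + (- + K + x u) ≤⟨ ℤ.+-monoʳ-≤ (- (+ K * + hops r)) -K+xu≤xw ⟩
    - (+ K * + hops r) + x w           ≤⟨ spread rep r ⟩
    x v                                ∎
    where
    open ℤ.≤-Reasoning
    one-more-hop : ∀ k h a → - (k * (+ 1 + h)) + a ≡ - (k * h) + (- k + a)
    one-more-hop = solve-∀
    -K+xu≤xw : - + K + x u ℤ.≤ x w
    -K+xu≤xw = from (-k+i≤j⇔i≤k+j (+ K) (x u) (x w)) (proj₁ (to (proj₁ rep u w (adjacent⇒≢ a)) a))

  module Leftmost (lbound : Fin n → Maybe ℚ) {v₀ b₀} (lb₀ : lbound v₀ ≡ just b₀)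
                  (connected : Connected G) (n≤K : n ≤ K) where

    ceiling : ℚ → ℤ
    ceiling b = proj₁ (ceiling-/ b k)

    ≤/K⇔ceiling≤ : ∀ b z → b ℚ.≤ z / K ⇔ ceiling b ℤ.≤ z
    ≤/K⇔ceiling≤ b = proj₂ (ceiling-/ b k)

    -- A vertex without a bound of its own is at most K grid steps left of each neighbour,
    -- hence at most K·h steps left of v₀ when h hops away from it.
    lowerOf : Maybe ℚ → ℕ → ℤ
    lowerOf (just b) _ = ceiling b
    lowerOf nothing  h = - (+ K * + h) + ceiling b₀

    lower : Fin n → ℤ
    lower v = lowerOf (lbound v) (hops (connected v₀ v))

    RespectsBounds : Positions n → Set
    RespectsBounds ℓ = ∀ v → AboveLB (lbound v) (ℓ v)

    bounds⇒lower≤ : ∀ {ℓ x} → ℓ ≗ x /K → IntegerRep x → RespectsBounds ℓ → ∀ v → lower v ℤ.≤ x v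
    bounds⇒lower≤ {ℓ} {x} ℓ≡ rep bounds v with lbound v | bounds v
    ... | just b  | b≤ℓv = to (≤/K⇔ceiling≤ b (x v)) (subst (b ℚ.≤_) (ℓ≡ v) b≤ℓv)
    ... | nothing | _    =
      ℤ.≤-trans (ℤ.+-monoʳ-≤ (- (+ K * + hops (connected v₀ v))) ceiling≤xv₀) (spread rep (connected v₀ v))
      where
      ceiling≤xv₀ : ceiling b₀ ℤ.≤ x v₀
      ceiling≤xv₀ = to (≤/K⇔ceiling≤ b₀ (x v₀))
        (subst (b₀ ℚ.≤_) (ℓ≡ v₀) (subst (λ m → AboveLB m (ℓ v₀)) lb₀ (bounds v₀)))

    lower≤⇒bounds : ∀ {ℓ x} → ℓ ≗ x /K → (∀ v → lower v ℤ.≤ x v) → RespectsBounds ℓ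
    lower≤⇒bounds {ℓ} {x} ℓ≡ lower≤ v with lbound v | lower≤ v
    ... | just b  | ceiling≤ = subst (b ℚ.≤_) (≡.sym (ℓ≡ v)) (from (≤/K⇔ceiling≤ b (x v)) ceiling≤)
    ... | nothing | _        = _

    open DifferenceConstraints constraint
    open BellmanFord (noPositiveCycles n≤K) lower
    open LeastSolutionAbove leastSolution

    leftmost : IsLeftmost G K _≺_ lbound (onGrid point)
    leftmost = inRep , point-least
      where
      inRep : InRep G K _≺_ lbound (onGrid point)
      inRep = let rep , before = from (gridRep⇔ (onGrid≡ point)) (solution⇒integerRep solution)
              in  rep , (λ v → point v , refl) , before , lower≤⇒bounds (onGrid≡ point) above
      point-least : ∀ ℓ → InRep G K _≺_ lbound ℓ → onGrid point ≤R ℓ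
      point-least ℓ (rep , grid , before , bounds) v = begin
        onGrid point v ≡⟨ onGrid≡ point v ⟩
        point v / K    ≤⟨ /-mono-≤ (least x (integerRep⇒solution x-rep) (bounds⇒lower≤ ℓ≡ x-rep bounds) v) ⟩
        x v / K        ≡⟨ ℓ≡ v ⟨
        ℓ v            ∎
        where
        open ℚ.≤-Reasoning
        x : Fin n → ℤ
        x v = proj₁ (grid v)
        ℓ≡ : ℓ ≗ x /K
        ℓ≡ v = trans (proj₂ (grid v)) (onGrid≡ x v)
        x-rep : IntegerRep x
        x-rep = to (gridRep⇔ ℓ≡) (rep , before)

leftmost-unique : ∀ {n} {G : Graph n} {K} .{{_ : NonZero K}} {_≺_ lbound} {ℓ ℓ′ : Positions n} →
                  IsLeftmost G K _≺_ lbound ℓ → IsLeftmost G K _≺_ lbound ℓ′ → ∀ v → ℓ v ≡ ℓ′ v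
leftmost-unique (inRep , least) (inRep′ , least′) v = ℚ.≤-antisym (least _ inRep′ v) (least′ _ inRep v)

mainTheorem3 : (n : ℕ) (G : Graph n) → Connected G → IsUnitIntervalGraph G →
    (lbound : Fin n → Maybe ℚ) → (∃ λ v → ∃ λ b → lbound v ≡ just b) →
    (K : ℕ) → .{{_ : NonZero K}} → n ≤ K →
    (_≺_ : Fin n → Fin n → Set) → AdmissibleOrder G _≺_ →
    (∃ λ ℓ → IsLeftmost G K _≺_ lbound ℓ)
    × (∀ ℓ ℓ' → IsLeftmost G K _≺_ lbound ℓ → IsLeftmost G K _≺_ lbound ℓ' → ∀ v → ℓ v ≡ ℓ' v)
mainTheorem3 .zero G _ _ _ (() , _) zero z≤n _ _
mainTheorem3 n G connected _ lbound (v₀ , b₀ , lb₀) (suc k) n≤K _≺_ order =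
  (_ , leftmost) , λ _ _ → leftmost-unique {G = G} {_≺_ = _≺_} {lbound}
  where
  open GridRepresentations G order k
  open Leftmost lbound lb₀ connected n≤K
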